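{- Let $k\ge r\ge3$, $p,t\ge0$, and let $\pi\in\mathbb{C}_{<}(k,r|p,t)$ be such that $\pi^{(2)}_p=2t+2$ and $\pi^{(2)}_p$ is of starting type $s_3$. Let $p_1$ be the first starting cluster index of $\pi$. Then the number $\pi^{(2)}_{p_1}+4$ occurs at most once as a part of $\pi$.
   Context: A partition is a finite non-increasing sequence of positive integers. $\mathbb{C}(k,r)$ is the set of partitions $\pi=(\pi_1,\dots,\pi_\ell)$ with no repeated odd part, $\pi_i\ge\pi_{i+k-1}+2$ for $1\le i\le\ell-k+1$ (strict if $\pi_i$ even), and at most $r-1$ parts $\le2$. Göllnitz–Gordon marking $GG(\pi)$: marks (positive integers) are assigned to the parts from smallest to largest, each as small as possible subject to: the mark of $\pi_i$ differs from the marks of all parts $\pi_g$, $g>i$, with $\pi_i-\pi_g\le2$ (strict if $\pi_i$ odd). A "$j$-marked $x$" is a part $x$ with mark $j$. $N_j$ is the number of $j$-marked parts and $\pi^{(j)}_1>\cdots>\pi^{(j)}_{N_j}$ are these parts; $\pi^{(j)}_0=+\infty$, $\pi^{(j)}_{N_j+1}=-\infty$. Starting types (for $N_2\ge1$): let $l$ be the largest integer $0\le l\le N_2$ such that no odd part of $\pi$ is $\ge\pi^{(2)}_l$; parts $\pi^{(2)}_i$, $i>l$, are of type $s_{ -1}$. For $b=1$: $\pi^{(2)}_1$ is of type $s_0$ [resp. $s_1$] with $s_1(\pi)=\pi^{(2)}_1-1$ [resp. $-2$] if there is a 1-marked $\pi^{(2)}_1-1$ [resp. $\pi^{(2)}_1-2$]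 and $\pi^{(2)}_1+2$ does not occur; of type $s_2$ ($s_1(\pi)=\pi^{(2)}_1+2$) if there is a 1-marked $\pi^{(2)}_1+2$; of type $s_3$ ($s_1(\pi)=\pi^{(2)}_1$) if there is a 1-marked $\pi^{(2)}_1$. For $b=2,\dots,l$: type $s_0$ [resp. $s_1$], $s_b(\pi)=\pi^{(2)}_b-1$ [resp. $-2$], if there is a 1-marked $\pi^{(2)}_b-1$ [resp. $-2$] and, whenever a 1-marked $\pi^{(2)}_b+2$ exists, $s_{b-1}(\pi)=\pi^{(2)}_b+2$; type $s_2$ ($s_b(\pi)=\pi^{(2)}_b+2$) if there is a 1-marked $\pi^{(2)}_b+2$ and $s_{b-1}(\pi)\neq\pi^{(2)}_b+2$; type $s_3$ ($s_b(\pi)=\pi^{(2)}_b$) if there is a 1-marked $\pi^{(2)}_b$. $\mathbb{C}_{<}(k,r|p,t)$ is the set of $\pi\in\mathbb{C}(k,r)$ such that: (1) no odd part is $\ge2t+1$; (2) $\pi^{(2)}_{p+1}<2t+1<\pi^{(2)}_p$; (3) if $\pi^{(2)}_p=2t+2$ it is of starting type $s_2$ or $s_3$; (4) if $\pi^{(2)}_{p+1}=2t$ it is of starting type $s_0$ or $s_1$. First starting cluster index (for $p\ge1$): $p_1$ is the smallest integer $p_1\le p$ such that $\pi^{(2)}_{p_1}=\pi^{(2)}_{p}+4(p-p_1)$ and $\pi^{(2)}_{p},\pi^{(2)}_{p-1},\dots,\pi^{(2)}_{p_1}$ are all of the same starting type. -}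

module Defs where

open import Data.Nat using (ℕ; zero; suc; _+_; _*_; _∸_; _≤_; _<_; _≡ᵇ_; _≤ᵇ_; _<ᵇ_; _≟_; _%_)
open import Data.Bool using (Bool; true; false; if_then_else_; _∧_; _∨_; not)
open import Data.List using (List; []; _∷_; length; map; filter; reverse; _++_)
open import Data.Bool.ListAction using (any; all)
open import Data.Product using (_×_; _,_; proj₁; proj₂; ∃)
open import Data.Sum using (_⊎_)
open import Data.Maybe using (Maybe; just; nothing)
open import Data.Unit using (⊤)
open import Data.Empty using (⊥)
open import Relation.Binary.PropositionalEquality using (_≡_)
open import Relation.Nullary using (¬_)

isOdd : ℕ → Bool
isOdd n = n % 2 ≡ᵇ 1

Odd : ℕ → Set
Odd n = n % 2 ≡ 1

Even : ℕ → Set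
Even n = n % 2 ≡ 0

-- 1-based indexing into a list: π_i (default 0 when out of range; only
-- ever used for 1 ≤ i ≤ length)
at : List ℕ → ℕ → ℕ
at []       _             = 0
at (x ∷ xs) zero          = 0
at (x ∷ xs) (suc zero)    = x
at (x ∷ xs) (suc (suc i)) = at xs (suc i)

count : ℕ → List ℕ → ℕ
count v π = length (filter (_≟ v) π)

-- π = (π_1,…,π_ℓ) stored as a list, π_1 first.
IsPartition : List ℕ → Set
IsPartition π =
  (∀ i → 1 ≤ i → i ≤ length π → 1 ≤ at π i) ×
  (∀ i → 1 ≤ i → i < length π → at π (suc i) ≤ at π i)

InC : ℕ → ℕ → List ℕ → Set
InC k r π =
  IsPartition π ×
  (∀ i j → 1 ≤ i → i < j → j ≤ length π → at π i ≡ at π j → Even (at π i)) ×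
  (∀ i → 1 ≤ i → i + k ∸ 1 ≤ length π →
       (Even (at π i) → at π (i + k ∸ 1) + 2 < at π i) ×
       (Odd (at π i) → at π (i + k ∸ 1) + 2 ≤ at π i)) ×
  (length (filter (_≤? 2) π) ≤ r ∸ 1)
  where open import Data.Nat using (_≤?_)

-- Göllnitz–Gordon marking

mexFrom : ℕ → ℕ → List ℕ → ℕ
mexFrom m zero     ms = m
mexFrom m (suc f)  ms = if any (λ x → x ≡ᵇ m) ms then mexFrom (suc m) f ms else m

mex₁ : List ℕ → ℕ
mex₁ ms = mexFrom 1 (suc (length ms)) ms

-- does the already-marked part y (y ≤ x) constrain the mark of x?
-- x - y ≤ 2, strictly if x is odd
close : ℕ → ℕ → Bool
close x y = if isOdd x then (x ∸ y) <ᵇ 2 else (x ∸ y) ≤ᵇ 2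

-- marks parts in increasing order; acc holds the already-marked
-- (smaller) parts as (part , mark)
markAsc : List (ℕ × ℕ) → List ℕ → List (ℕ × ℕ)
markAsc acc []       = acc
markAsc acc (x ∷ xs) =
  markAsc (acc ++ ((x , mex₁ (map proj₂ (filterᵇ (λ q → close x (proj₁ q)) acc))) ∷ [])) xs
  where open import Data.List using (filterᵇ)

GG : List ℕ → List (ℕ × ℕ)
GG π = reverse (markAsc [] (reverse π))

hasMarked : ℕ → List ℕ → ℕ → Bool
hasMarked j π y = any (λ q → (proj₁ q ≡ᵇ y) ∧ (proj₂ q ≡ᵇ j)) (GG π)

occursᵇ : List ℕ → ℕ → Bool
occursᵇ π y = any (λ x → x ≡ᵇ y) π

-- the j-marked parts π^{(j)}_1 > … > π^{(j)}_{N_j}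
sub : ℕ → List ℕ → List ℕ
sub j π = map proj₁ (filterᵇ (λ q → proj₂ q ≡ᵇ j) (GG π))
  where open import Data.List using (filterᵇ)

N : ℕ → List ℕ → ℕ
N j π = length (sub j π)

-- Extended naturals for π^{(j)}_0 = +∞, π^{(j)}_{N_j+1} = -∞

data ℕ∞ : Set where
  -∞  : ℕ∞
  fin : ℕ → ℕ∞
  +∞  : ℕ∞

_<ᵉ_ : ℕ∞ → ℕ∞ → Set
-∞    <ᵉ -∞    = ⊥
-∞    <ᵉ fin _ = ⊤
-∞    <ᵉ +∞    = ⊤
fin _ <ᵉ -∞    = ⊥
fin m <ᵉ fin n = m < n
fin _ <ᵉ +∞    = ⊤
+∞    <ᵉ _     = ⊥

-- π^{(j)}_i : +∞ for i = 0, the i-th j-marked part for 1 ≤ i ≤ N_j,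
-- -∞ for i ≥ N_j + 1 (only i = N_j + 1 is ever relevant)
subᵉ : ℕ → List ℕ → ℕ → ℕ∞
subᵉ j π zero    = +∞
subᵉ j π (suc i) = if suc i ≤ᵇ N j π then fin (at (sub j π) (suc i)) else -∞

data SType : Set where
  s₋₁ s₀ s₁ s₂ s₃ : SType

noOddGe : List ℕ → ℕ → Bool
noOddGe π zero    = true     -- π^{(2)}_0 = +∞
noOddGe π (suc l) = all (λ x → not (isOdd x ∧ (at (sub 2 π) (suc l) ≤ᵇ x))) π

largestL : List ℕ → ℕ → ℕ
largestL π zero    = zero
largestL π (suc n) = if noOddGe π (suc n) then suc n else largestL π n

lIdx : List ℕ → ℕ
lIdx π = largestL π (N 2 π)

eqMaybe : Maybe ℕ → ℕ → Bool
eqMaybe nothing  _ = false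
eqMaybe (just m) n = m ≡ᵇ n

-- classification of x = π^{(2)}_b; 'first' says b = 1, 'prev' is s_{b-1}(π).
-- Returns the starting type together with s_b(π).
classify : List ℕ → Bool → Maybe ℕ → ℕ → Maybe (SType × ℕ)
classify π first prev x =
  if hasMarked 1 π x then just (s₃ , x)
  else if hasMarked 1 π (x + 2) ∧ (first ∨ not (eqMaybe prev (x + 2)))
    then just (s₂ , x + 2)
  else if hasMarked 1 π (x ∸ 1) ∧ cond0 then just (s₀ , x ∸ 1)
  else if hasMarked 1 π (x ∸ 2) ∧ cond0 then just (s₁ , x ∸ 2)
  else nothing
  where
  cond0 : Bool
  cond0 = if first then not (occursᵇ π (x + 2))
          else (not (hasMarked 1 π (x + 2)) ∨ eqMaybe prev (x + 2))

-- type and value s_b(π) for 1 ≤ b ≤ l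
startTV : List ℕ → ℕ → Maybe (SType × ℕ)
startTV π zero    = nothing
startTV π (suc b) =
  classify π (b ≡ᵇ 0) (Data.Maybe.map proj₂ (startTV π b)) (at (sub 2 π) (suc b))
  where import Data.Maybe

OfStartType : List ℕ → ℕ → SType → Set
OfStartType π b a =
  (1 ≤ b × b ≤ lIdx π × ∃ λ v → startTV π b ≡ just (a , v)) ⊎
  (lIdx π < b × b ≤ N 2 π × a ≡ s₋₁)

InCless : ℕ → ℕ → ℕ → ℕ → List ℕ → Set
InCless k r p t π =
  InC k r π ×
  (∀ x → x ∈ π → Odd x → x < 2 * t + 1) ×
  (subᵉ 2 π (suc p) <ᵉ fin (2 * t + 1) × fin (2 * t + 1) <ᵉ subᵉ 2 π p) ×
  (subᵉ 2 π p ≡ fin (2 * t + 2) → OfStartType π p s₂ ⊎ OfStartType π p s₃) ×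
  (subᵉ 2 π (suc p) ≡ fin (2 * t) → OfStartType π (suc p) s₀ ⊎ OfStartType π (suc p) s₁)
  where open import Data.List.Membership.Propositional using (_∈_)

ClusterCond : List ℕ → ℕ → ℕ → Set
ClusterCond π p q =
  subᵉ 2 π q ≡ fin (at (sub 2 π) p + 4 * (p ∸ q)) ×
  ∃ λ a → ∀ i → q ≤ i → i ≤ p → OfStartType π i a

IsFirstCluster : List ℕ → ℕ → ℕ → Set
IsFirstCluster π p p₁ =
  p₁ ≤ p × ClusterCond π p p₁ × (∀ q → q < p₁ → ¬ ClusterCond π p q)

{-# OPTIONS --safe #-}
module Submission where

-- Let v = π⁽²⁾_{p₁}. The first cluster has the type s₃ of π⁽²⁾_p, so v carries
-- the mark 2 and also has a 1-marked copy, and v = 2t + 2 + 4(p − p₁) is even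
-- and exceeds every odd part. Hence v + 1 and v + 3 are not parts, while v + 2,
-- being close to a 1-marked and a 2-marked v, gets a mark ≥ 3: no part strictly
-- between v and v + 4 is marked 1 or 2. If v + 4 occurred twice, the greedy
-- marking would then give its copies the marks 1 and 2. As the 2-marked parts
-- strictly decrease, the 2-marked part just before v lies in (v, v + 4], so it is
-- v + 4; being 1-marked as well it has type s₃, and p₁ − 1 would already satisfy
-- the cluster condition, against the minimality of p₁.

open import Data.Nat using (ℕ; zero; suc; _+_; _*_; _∸_; _≤_; _<_; _≥_; _>_; _≡ᵇ_; _≤ᵇ_; _≟_; _%_; z≤n; s≤s; s≤s⁻¹)
open import Data.Nat.Properties
open import Data.Nat.DivMod using (%-distribˡ-+; m%n%n≡m%n; m*n%n≡0)
open import Data.Bool using (Bool; true; false; T; if_then_else_; _∧_; _∨_; not)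
open import Data.Bool.Properties using (T-∧)
open import Data.Bool.ListAction using (any)
open import Data.List using (List; []; _∷_; [_]; length; map; filterᵇ; reverse; _++_)
open import Data.List.Properties using (filter-accept; filter-reject; map-++; ++-assoc; ++-identityʳ; reverse-++; reverse-involutive; reverse-map)
open import Data.List.Membership.Propositional using (_∈_; _∉_)
open import Data.List.Membership.Propositional.Properties using (∈-map⁺; ∈-map⁻; ∈-map∘filter⁺; ∈-map∘filter⁻)
open import Data.List.Membership.DecPropositional _≟_ using (_∈?_)
open import Data.List.Relation.Unary.Any using (here; there)
import Data.List.Relation.Unary.Any as Any
open import Data.List.Relation.Unary.Any.Properties using (any⁺; any⁻; reverse⁺; reverse⁻)
import Data.List.Relation.Unary.All as All
open import Data.List.Relation.Unary.AllPairs using (AllPairs; []; _∷_)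
import Data.List.Relation.Unary.AllPairs.Properties as AllPairs
open import Data.List.Relation.Unary.Linked using (Linked; []; [-]; _∷_)
open import Data.List.Relation.Unary.Linked.Properties using (Linked⇒AllPairs)
open import Data.Maybe using (Maybe; just; nothing) renaming (map to mapₘ)
open import Data.Product using (_×_; _,_; proj₁; proj₂; ∃)
open import Data.Sum using (_⊎_; inj₁; inj₂)
open import Data.Empty using (⊥)
open import Function using (_∘_; _on_; Equivalence)
open import Level using (0ℓ)
open import Relation.Binary using (Rel)
open import Relation.Nullary using (yes; no; contradiction)
open import Relation.Nullary.Decidable using (T?)
open import Relation.Binary.PropositionalEquality hiding ([_])
open import Defs

∈⇒any-≡ᵇ : ∀ {j xs} → j ∈ xs → T (any (_≡ᵇ j) xs)
∈⇒any-≡ᵇ {j} = any⁺ _ ∘ Any.map (λ { refl → ≡⇒≡ᵇ j j refl })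

any-≡ᵇ⇒∈ : ∀ {j} xs → T (any (_≡ᵇ j) xs) → j ∈ xs
any-≡ᵇ⇒∈ xs = Any.map (sym ∘ ≡ᵇ⇒≡ _ _) ∘ any⁻ _ xs

mexFrom-≥ : ∀ m f ms → m ≤ mexFrom m f ms
mexFrom-≥ m zero    ms = ≤-refl
mexFrom-≥ m (suc f) ms with any (_≡ᵇ m) ms
... | true  = ≤-trans (n≤1+n m) (mexFrom-≥ (suc m) f ms)
... | false = ≤-refl

mex₁-≡1 : ∀ {ms} → 1 ∉ ms → mex₁ ms ≡ 1
mex₁-≡1 {ms} 1∉ with any (_≡ᵇ 1) ms | any-≡ᵇ⇒∈ {1} ms
... | false | _  = refl
... | true  | 1∈ = contradiction (1∈ _) 1∉

mex₁-≡2 : ∀ {ms} → 1 ∈ ms → 2 ∉ ms → mex₁ ms ≡ 2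
mex₁-≡2 {ms@(_ ∷ _)} 1∈ 2∉ with any (_≡ᵇ 1) ms | ∈⇒any-≡ᵇ 1∈ | any (_≡ᵇ 2) ms | any-≡ᵇ⇒∈ {2} ms
... | true | _ | false | _  = refl
... | true | _ | true  | 2∈ = contradiction (2∈ _) 2∉

mex₁-≥3 : ∀ {ms} → 1 ∈ ms → 2 ∈ ms → 3 ≤ mex₁ ms
mex₁-≥3 {ms@(_ ∷ ms′)} 1∈ 2∈ with any (_≡ᵇ 1) ms | ∈⇒any-≡ᵇ 1∈ | any (_≡ᵇ 2) ms | ∈⇒any-≡ᵇ 2∈
... | true | _ | true | _ = mexFrom-≥ 3 (length ms′) ms

mex₁-≢2 : ∀ {ms} → 2 ∈ ms → mex₁ ms ≢ 2
mex₁-≢2 {ms} 2∈ mex≡2 with 1 ∈? ms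
... | no  1∉ = contradiction (trans (sym (mex₁-≡1 1∉)) mex≡2) λ ()
... | yes 1∈ = contradiction (subst (3 ≤_) mex≡2 (mex₁-≥3 1∈ 2∈)) (n≮n 2)

Marked : Set
Marked = ℕ × ℕ

-- The reverse only mirrors the accumulator order of markAsc; just membership matters.
marksNear : ℕ → List Marked → List ℕ
marksNear x D = map proj₂ (filterᵇ (close x ∘ proj₁) (reverse D))

∈-marksNear⁺ : ∀ {x y j D} → (y , j) ∈ D → T (close x y) → j ∈ marksNear x D
∈-marksNear⁺ {x} y∈ c = ∈-map∘filter⁺ proj₂ (T? ∘ close x ∘ proj₁) (_ , reverse⁺ y∈ , refl , c)

∈-marksNear⁻ : ∀ {x j D} → j ∈ marksNear x D → ∃ λ y → (y , j) ∈ D × T (close x y)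
∈-marksNear⁻ {x} j∈ with (y , _) , y∈ , refl , c ← ∈-map∘filter⁻ proj₂ (T? ∘ close x ∘ proj₁) j∈ =
  y , reverse⁻ y∈ , c

-- In GG π the entries after a part are the smaller parts, which were marked first.
data Greedy : List Marked → Set where
  []  : Greedy []
  _∷_ : ∀ {x m D} → m ≡ mex₁ (marksNear x D) → Greedy D → Greedy ((x , m) ∷ D)

Descending : List Marked → Set
Descending = AllPairs (_≥_ on proj₁)

markAsc-greedy : ∀ acc xs → Greedy (reverse acc) → Greedy (reverse (markAsc acc xs))
markAsc-greedy acc []       g = g
markAsc-greedy acc (x ∷ xs) g =
  markAsc-greedy _ xs (subst Greedy (sym (reverse-++ acc [ _ ])) (mark≡ ∷ g))
  where
  mark≡ : mex₁ (map proj₂ (filterᵇ (close x ∘ proj₁) acc)) ≡ mex₁ (marksNear x (reverse acc))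
  mark≡ = cong (mex₁ ∘ map proj₂ ∘ filterᵇ (close x ∘ proj₁)) (sym (reverse-involutive acc))

GG-greedy : ∀ π → Greedy (GG π)
GG-greedy π = markAsc-greedy [] (reverse π) []

map-proj₁-markAsc : ∀ acc xs → map proj₁ (markAsc acc xs) ≡ map proj₁ acc ++ xs
map-proj₁-markAsc acc []       = sym (++-identityʳ _)
map-proj₁-markAsc acc (x ∷ xs) = begin
  map proj₁ (markAsc (acc ++ [ _ ]) xs)  ≡⟨ map-proj₁-markAsc (acc ++ [ _ ]) xs ⟩
  map proj₁ (acc ++ [ _ ]) ++ xs         ≡⟨ cong (_++ xs) (map-++ proj₁ acc [ _ ]) ⟩
  (map proj₁ acc ++ [ x ]) ++ xs         ≡⟨ ++-assoc (map proj₁ acc) [ x ] xs ⟩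
  map proj₁ acc ++ x ∷ xs                ∎
  where open ≡-Reasoning

map-proj₁-GG : ∀ π → map proj₁ (GG π) ≡ π
map-proj₁-GG π = begin
  map proj₁ (reverse (markAsc [] (reverse π)))  ≡⟨ reverse-map proj₁ (markAsc [] (reverse π)) ⟩
  reverse (map proj₁ (markAsc [] (reverse π)))  ≡⟨ cong reverse (map-proj₁-markAsc [] (reverse π)) ⟩
  reverse (reverse π)                           ≡⟨ reverse-involutive π ⟩
  π                                             ∎
  where open ≡-Reasoning

∈-GG⇒∈ : ∀ {π y j} → (y , j) ∈ GG π → y ∈ π
∈-GG⇒∈ {π} = subst (_ ∈_) (map-proj₁-GG π) ∘ ∈-map⁺ proj₁

GG-descending : ∀ {π} → AllPairs _≥_ π → Descending (GG π)
GG-descending {π} = AllPairs.map⁻ ∘ subst (AllPairs _≥_) (sym (map-proj₁-GG π))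

count-≢ : ∀ {a x} xs → x ≢ a → count a (x ∷ xs) ≡ count a xs
count-≢ {a} xs x≢a = cong length (filter-reject (_≟ a) x≢a)

count-≡ : ∀ {a} xs → count a (a ∷ xs) ≡ suc (count a xs)
count-≡ {a} xs = cong length (filter-accept (_≟ a) refl)

count>0⇒∈ : ∀ {a} xs → 0 < count a xs → a ∈ xs
count>0⇒∈ {a} (x ∷ xs) pos with x ≟ a
... | yes refl = here refl
... | no  x≢a  = there (count>0⇒∈ xs (subst (0 <_) (count-≢ xs x≢a) pos))

close-refl : ∀ x → T (close x x)
close-refl x rewrite n∸n≡0 x with isOdd x
... | true  = _
... | false = _

drop-larger-head : ∀ {y j z m} {E : List Marked} → y < z → (y , j) ∈ (z , m) ∷ E → (y , j) ∈ E
drop-larger-head y<z (here refl) = contradiction y<z (n≮n _)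
drop-larger-head _   (there y∈)  = y∈

mark-above-doubly-marked : ∀ {E x m y} → Greedy E → Descending E →
  (x , m) ∈ E → (y , 1) ∈ E → (y , 2) ∈ E → y < x → T (close x y) → 3 ≤ m
mark-above-doubly-marked (m≡ ∷ _) _ (here refl) y¹ y² y<x c =
  subst (3 ≤_) (sym m≡) (mex₁-≥3 (∈-marksNear⁺ (drop-larger-head y<x y¹) c)
                                  (∈-marksNear⁺ (drop-larger-head y<x y²) c))
mark-above-doubly-marked (_ ∷ g) (z≥ ∷ d) (there x∈) y¹ y² y<x c =
  mark-above-doubly-marked g d x∈ (drop-larger-head y<z y¹) (drop-larger-head y<z y²) y<x c
  where y<z = <-≤-trans y<x (All.lookup z≥ x∈)

2-marked-strictly-decreasing : ∀ {D} → Greedy D → Descending D →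
  AllPairs _>_ (map proj₁ (filterᵇ (λ q → proj₂ q ≡ᵇ 2) D))
2-marked-strictly-decreasing []                      []        = []
2-marked-strictly-decreasing {(x , m) ∷ D} (m≡ ∷ g) (x≥ ∷ d) with m ≡ᵇ 2 in m≡ᵇ2
... | false = 2-marked-strictly-decreasing g d
... | true  = All.tabulate below ∷ 2-marked-strictly-decreasing g d
  where
  below : ∀ {y} → y ∈ map proj₁ (filterᵇ (λ q → proj₂ q ≡ᵇ 2) D) → y < x
  below y∈ with (y , j) , y∈D , refl , j≡ᵇ2 ← ∈-map∘filter⁻ proj₁ (T? ∘ (λ q → proj₂ q ≡ᵇ 2)) y∈ =
    ≤∧≢⇒< (All.lookup x≥ y∈D) λ { refl →
      mex₁-≢2 (∈-marksNear⁺ (subst (λ k → (y , k) ∈ D) (≡ᵇ⇒≡ j 2 j≡ᵇ2) y∈D) (close-refl y))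
              (trans (sym m≡) (≡ᵇ⇒≡ m 2 (subst T (sym m≡ᵇ2) _))) }

HighMarksBelow : ℕ → List Marked → Set
HighMarksBelow a E = ∀ {y j} → (y , j) ∈ E → y < a → T (close a y) → 3 ≤ j

low-mark-near-is-copy : ∀ {a m E j} → Descending ((a , m) ∷ E) → HighMarksBelow a E →
  j ∈ marksNear a E → j ≤ 2 → (a , j) ∈ E
low-mark-near-is-copy (a≥ ∷ _) high j∈ j≤2 with y , y∈ , c ← ∈-marksNear⁻ j∈
  with m≤n⇒m<n∨m≡n (All.lookup a≥ y∈)
... | inj₁ y<a  = contradiction (≤-trans (high y∈ y<a c) j≤2) (n≮n 2)
... | inj₂ refl = y∈

copy-1-marked : ∀ {a m E} → Greedy E → Descending E → HighMarksBelow a E → (a , m) ∈ E → (a , 1) ∈ E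
copy-1-marked {a} {E = _ ∷ E} (m≡ ∷ _) d high (here refl) with 1 ∈? marksNear a E
... | yes 1∈ = there (low-mark-near-is-copy d (high ∘ there) 1∈ (s≤s z≤n))
... | no  1∉ = here (cong (a ,_) (sym (trans m≡ (mex₁-≡1 1∉))))
copy-1-marked (_ ∷ g) (_ ∷ d) high (there a∈) = there (copy-1-marked g d (high ∘ there) a∈)

copy-2-marked : ∀ {a E} → Greedy E → Descending E → HighMarksBelow a E →
  2 ≤ count a (map proj₁ E) → (a , 2) ∈ E
copy-2-marked {a} {(x , _) ∷ E} (m≡ ∷ g) d@(_ ∷ d′) high twice with x ≟ a
... | no x≢a = there (copy-2-marked g d′ (high ∘ there) (subst (2 ≤_) (count-≢ _ x≢a) twice))
... | yes refl with 2 ∈? marksNear a E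
...   | yes 2∈ = there (low-mark-near-is-copy d (high ∘ there) 2∈ ≤-refl)
...   | no  2∉ = here (cong (a ,_) (sym (trans m≡ (mex₁-≡2 1∈ 2∉))))
  where
  a∈ : a ∈ map proj₁ E
  a∈ = count>0⇒∈ _ (s≤s⁻¹ (subst (2 ≤_) (count-≡ {a} (map proj₁ E)) twice))
  1∈ : 1 ∈ marksNear a E
  1∈ with _ , a∈′ , refl ← ∈-map⁻ proj₁ a∈ =
    ∈-marksNear⁺ (copy-1-marked g d′ (high ∘ there) a∈′) (close-refl a)

[m+n]%2≡n%2 : ∀ {m} n → Even m → (m + n) % 2 ≡ n % 2
[m+n]%2≡n%2 {m} n m-even = begin
  (m + n) % 2          ≡⟨ %-distribˡ-+ m n 2 ⟩
  (m % 2 + n % 2) % 2  ≡⟨ cong (λ r → (r + n % 2) % 2) m-even ⟩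
  n % 2 % 2            ≡⟨ m%n%n≡m%n n 2 ⟩
  n % 2                ∎
  where open ≡-Reasoning

even-2* : ∀ n → Even (2 * n)
even-2* n = trans (cong (_% 2) (*-comm 2 n)) (m*n%n≡0 n 2)

even-progression : ∀ t K → Even (2 * t + 2 + 4 * K)
even-progression t K = trans ([m+n]%2≡n%2 {2 * t + 2} (4 * K) ([m+n]%2≡n%2 {2 * t} 2 (even-2* t)))
                             (subst Even (sym (*-assoc 2 2 K)) (even-2* (2 * K)))

close-even⇒ : ∀ {x y} → Even x → T (close x y) → x ≤ y + 2
close-even⇒ {x} {y} x-even c rewrite x-even =
  ≤-trans (m≤n+m∸n x y) (+-monoʳ-≤ y (≤ᵇ⇒≤ (x ∸ y) 2 c))

close-even⇐ : ∀ {x y} → Even x → x ∸ y ≤ 2 → T (close x y)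
close-even⇐ x-even x∸y≤2 rewrite x-even = ≤⇒≤ᵇ x∸y≤2

strictly-between : ∀ {v y} → v < y → y < v + 4 → y ≡ v + 1 ⊎ y ≡ v + 2 ⊎ y ≡ v + 3
strictly-between {v} {y} v<y y<v+4 = by-offset (y ∸ v) (sym (m+[n∸m]≡n (<⇒≤ v<y)))
  where
  by-offset : ∀ d → y ≡ v + d → y ≡ v + 1 ⊎ y ≡ v + 2 ⊎ y ≡ v + 3
  by-offset 0 refl = contradiction v<y (<-irrefl (sym (+-identityʳ v)))
  by-offset 1 y≡   = inj₁ y≡
  by-offset 2 y≡   = inj₂ (inj₁ y≡)
  by-offset 3 y≡   = inj₂ (inj₂ y≡)
  by-offset (suc (suc (suc (suc d)))) refl =
    contradiction (+-cancelˡ-< v _ 4 y<v+4) λ { (s≤s (s≤s (s≤s (s≤s ())))) }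

module AboveDoublyMarked {D : List Marked} (greedy : Greedy D) (descending : Descending D)
  {v : ℕ} (v-even : Even v) (odd-below-v : ∀ {y j} → (y , j) ∈ D → Odd y → y < v)
  (v¹ : (v , 1) ∈ D) (v² : (v , 2) ∈ D) where

  high-marks-between-v-and-v+4 : ∀ {y j} → (y , j) ∈ D → v < y → y < v + 4 → 3 ≤ j
  high-marks-between-v-and-v+4 y∈ v<y y<v+4 with strictly-between v<y y<v+4
  ... | inj₁ refl        = contradiction (odd-below-v y∈ ([m+n]%2≡n%2 {v} 1 v-even)) (m+n≮m _ 1)
  ... | inj₂ (inj₂ refl) = contradiction (odd-below-v y∈ ([m+n]%2≡n%2 {v} 3 v-even)) (m+n≮m _ 3)
  ... | inj₂ (inj₁ refl) = mark-above-doubly-marked greedy descending y∈ v¹ v² (m<m+n v (s≤s z≤n))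
      (close-even⇐ {v + 2} {v} ([m+n]%2≡n%2 {v} 2 v-even) (≤-reflexive (m+n∸m≡n v 2)))

  high-marks-below-v+4 : HighMarksBelow (v + 4) D
  high-marks-below-v+4 {y} y∈ y<v+4 c = high-marks-between-v-and-v+4 y∈ v<y y<v+4
    where
    v<y : v < y
    v<y = +-cancelʳ-≤ 2 (suc v) y (begin
      suc v + 2  ≡⟨ +-suc v 2 ⟨
      v + 3      ≤⟨ +-monoʳ-≤ v (n≤1+n 3) ⟩
      v + 4      ≤⟨ close-even⇒ {v + 4} ([m+n]%2≡n%2 {v} 4 v-even) c ⟩
      y + 2      ∎)
      where open ≤-Reasoning

  repeated-v+4-doubly-marked : 2 ≤ count (v + 4) (map proj₁ D) → (v + 4 , 1) ∈ D × (v + 4 , 2) ∈ D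
  repeated-v+4-doubly-marked twice =
    copy-1-marked greedy descending high-marks-below-v+4 v+4² , v+4²
    where v+4² = copy-2-marked greedy descending high-marks-below-v+4 twice

  2-marked-above-v≡v+4 : ∀ {w} → (w , 2) ∈ D → v < w → w ≤ v + 4 → w ≡ v + 4
  2-marked-above-v≡v+4 w∈ v<w w≤v+4 with m≤n⇒m<n∨m≡n w≤v+4
  ... | inj₁ w<v+4 = contradiction (high-marks-between-v-and-v+4 w∈ v<w w<v+4) (n≮n 2)
  ... | inj₂ w≡v+4 = w≡v+4

at-∈ : ∀ {xs} i → suc i ≤ length xs → at xs (suc i) ∈ xs
at-∈ {_ ∷ _} zero    _        = here refl
at-∈ {_ ∷ _} (suc i) (s≤s i<) = there (at-∈ i i<)

at-linked : ∀ {R : Rel ℕ 0ℓ} xs →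
  (∀ i → 1 ≤ i → i < length xs → R (at xs i) (at xs (suc i))) → Linked R xs
at-linked []           _    = []
at-linked (x ∷ [])     _    = [-]
at-linked (x ∷ y ∷ xs) R-at = R-at 1 ≤-refl (s≤s (s≤s z≤n)) ∷ at-linked (y ∷ xs) R-at′
  where
  R-at′ : ∀ i → 1 ≤ i → i < length (y ∷ xs) → _
  R-at′ (suc i) _ i< = R-at (suc (suc i)) (s≤s z≤n) (s≤s i<)

partition-descending : ∀ {π} → IsPartition π → AllPairs _≥_ π
partition-descending {π} (_ , non-increasing) =
  Linked⇒AllPairs (λ x≥y y≥z → ≤-trans y≥z x≥y) (at-linked π non-increasing)

at-<-head : ∀ {x xs} i → AllPairs _>_ (x ∷ xs) → suc i ≤ length xs → at xs (suc i) < x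
at-<-head i (x> ∷ _) i< = All.lookup x> (at-∈ i i<)

at-≤-head : ∀ {x xs} i → AllPairs _>_ (x ∷ xs) → i ≤ length xs → at (x ∷ xs) (suc i) ≤ x
at-≤-head zero    _ _  = ≤-refl
at-≤-head (suc i) s i≤ = <⇒≤ (at-<-head i s i≤)

at-suc-< : ∀ {xs} i → AllPairs _>_ xs → suc (suc i) ≤ length xs → at xs (suc (suc i)) < at xs (suc i)
at-suc-< {_ ∷ _} zero    s       (s≤s i<) = at-<-head 0 s i<
at-suc-< {_ ∷ _} (suc i) (_ ∷ s) (s≤s i<) = at-suc-< i s i<

predecessor-between : ∀ {xs u} b → AllPairs _>_ xs → suc b ≤ length xs → u ∈ xs → at xs (suc b) < u →
  ∃ λ q → b ≡ suc q × at xs (suc b) < at xs (suc q) × at xs (suc q) ≤ u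
predecessor-between {x ∷ _} zero _ _ (here refl) x<x = contradiction x<x (n≮n x)
predecessor-between zero (x> ∷ _) _ (there u∈) x<u = contradiction (All.lookup x> u∈) (<⇒≯ x<u)
predecessor-between (suc b) s b< (here refl) _ =
  b , refl , at-suc-< b s b< , at-≤-head b s (s≤s⁻¹ (<⇒≤ b<))
predecessor-between (suc b) (_ ∷ s) (s≤s b<) (there u∈) at<u
  with q , refl , lt , le ← predecessor-between b s b< u∈ at<u = b , refl , lt , le

∈-sub⁻ : ∀ {j π w} → w ∈ sub j π → (w , j) ∈ GG π
∈-sub⁻ {j} w∈ with (_ , k) , w∈GG , refl , k≡ᵇj ← ∈-map∘filter⁻ proj₁ (T? ∘ λ q → proj₂ q ≡ᵇ j) w∈ =
  subst (λ k → (_ , k) ∈ _) (≡ᵇ⇒≡ k j k≡ᵇj) w∈GG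

∈-sub⁺ : ∀ {j π w} → (w , j) ∈ GG π → w ∈ sub j π
∈-sub⁺ {j} w∈ = ∈-map∘filter⁺ proj₁ (T? ∘ λ q → proj₂ q ≡ᵇ j) (_ , w∈ , refl , ≡⇒≡ᵇ j j refl)

subᵉ≡fin⇒ : ∀ {j π i w} → subᵉ j π (suc i) ≡ fin w → suc i ≤ N j π × at (sub j π) (suc i) ≡ w
subᵉ≡fin⇒ {j} {π} {i} eq with suc i ≤ᵇ N j π in i≤ᵇN
subᵉ≡fin⇒ {j} {π} {i} refl | true = ≤ᵇ⇒≤ (suc i) (N j π) (subst T (sym i≤ᵇN) _) , refl

subᵉ-at : ∀ {j π i} → suc i ≤ N j π → subᵉ j π (suc i) ≡ fin (at (sub j π) (suc i))
subᵉ-at {j} {π} {i} i≤N with suc i ≤ᵇ N j π | ≤⇒≤ᵇ i≤N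
... | true | _ = refl

fin-injective : ∀ {m n} → fin m ≡ fin n → m ≡ n
fin-injective refl = refl

hasMarked⇒∈ : ∀ {j π y} → T (hasMarked j π y) → (y , j) ∈ GG π
hasMarked⇒∈ {j} {π} {y} = Any.map matches ∘ any⁻ _ (GG π)
  where
  matches : ∀ {q} → T ((proj₁ q ≡ᵇ y) ∧ (proj₂ q ≡ᵇ j)) → (y , j) ≡ q
  matches {a , b} t with a≡ᵇy , b≡ᵇj ← Equivalence.to T-∧ t =
    sym (cong₂ _,_ (≡ᵇ⇒≡ a y a≡ᵇy) (≡ᵇ⇒≡ b j b≡ᵇj))

∈⇒hasMarked : ∀ {j π y} → (y , j) ∈ GG π → T (hasMarked j π y)
∈⇒hasMarked {j} {y = y} =
  any⁺ _ ∘ Any.map λ { refl → Equivalence.from T-∧ (≡⇒≡ᵇ y y refl , ≡⇒≡ᵇ j j refl) }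

later-branches-not-s₃ : ∀ c₂ c₀ c₁ {u₂ u₀ u₁ w} → _≢_ {A = Maybe (SType × ℕ)}
  (if c₂ then just (s₂ , u₂) else if c₀ then just (s₀ , u₀) else if c₁ then just (s₁ , u₁) else nothing)
  (just (s₃ , w))
later-branches-not-s₃ true  _     _     ()
later-branches-not-s₃ false true  _     ()
later-branches-not-s₃ false false true  ()
later-branches-not-s₃ false false false ()

classify-s₃⇒1-marked : ∀ {π} first prev {x w} →
  classify π first prev x ≡ just (s₃ , w) → T (hasMarked 1 π x)
classify-s₃⇒1-marked {π} first prev {x} eq with hasMarked 1 π x
... | true  = _
... | false = contradiction eq (later-branches-not-s₃ cond₂ (hasMarked 1 π (x ∸ 1) ∧ cond₀) (hasMarked 1 π (x ∸ 2) ∧ cond₀))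
  where
  cond₂ cond₀ : Bool
  cond₂ = hasMarked 1 π (x + 2) ∧ (first ∨ not (eqMaybe prev (x + 2)))
  cond₀ = if first then not (occursᵇ π (x + 2)) else (not (hasMarked 1 π (x + 2)) ∨ eqMaybe prev (x + 2))

classify-1-marked : ∀ {π} first prev {x} → T (hasMarked 1 π x) → classify π first prev x ≡ just (s₃ , x)
classify-1-marked {π} _ _ {x} h with hasMarked 1 π x | h
... | true | _ = refl

OfStartType-unique : ∀ {π b a a′} → OfStartType π b a → OfStartType π b a′ → a ≡ a′
OfStartType-unique (inj₁ (_ , _ , _ , eq)) (inj₁ (_ , _ , _ , eq′)) with refl ← trans (sym eq) eq′ = refl
OfStartType-unique (inj₁ (_ , b≤l , _))    (inj₂ (l<b , _))         = contradiction b≤l (<⇒≱ l<b)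
OfStartType-unique (inj₂ (l<b , _))        (inj₁ (_ , b≤l , _))     = contradiction b≤l (<⇒≱ l<b)
OfStartType-unique (inj₂ (_ , _ , refl))   (inj₂ (_ , _ , refl))    = refl

s₃⇒≤lIdx : ∀ {π b} → OfStartType π b s₃ → b ≤ lIdx π
s₃⇒≤lIdx (inj₁ (_ , b≤l , _)) = b≤l

s₃⇒1-marked : ∀ {π b x} → OfStartType π (suc b) s₃ → subᵉ 2 π (suc b) ≡ fin x → (x , 1) ∈ GG π
s₃⇒1-marked {π} {b} (inj₁ (_ , _ , _ , eq)) πb≡x with _ , refl ← subᵉ≡fin⇒ {π = π} πb≡x =
  hasMarked⇒∈ {π = π} (classify-s₃⇒1-marked {π} (b ≡ᵇ 0) (mapₘ proj₂ (startTV π b)) eq)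

1-marked⇒s₃ : ∀ {π b x} → suc b ≤ lIdx π → subᵉ 2 π (suc b) ≡ fin x → (x , 1) ∈ GG π →
  OfStartType π (suc b) s₃
1-marked⇒s₃ {π} {b} b≤l πb≡x x¹ with _ , refl ← subᵉ≡fin⇒ {π = π} πb≡x =
  inj₁ (s≤s z≤n , b≤l , _ ,
        classify-1-marked {π} (b ≡ᵇ 0) (mapₘ proj₂ (startTV π b)) (∈⇒hasMarked {π = π} x¹))

extend-cluster : ∀ {π p c a} → suc c ≤ p →
  (∀ i → suc c ≤ i → i ≤ p → OfStartType π i a) → OfStartType π c a →
  subᵉ 2 π c ≡ fin (at (sub 2 π) p + 4 * (p ∸ suc c) + 4) → ClusterCond π p c
extend-cluster {π} {p} {c} {a} c<p types c-type πc≡ = trans πc≡ (cong fin step-4) , a , types′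
  where
  X = at (sub 2 π) p
  K = p ∸ suc c
  step-4 : X + 4 * K + 4 ≡ X + 4 * (p ∸ c)
  step-4 = begin
    X + 4 * K + 4    ≡⟨ +-assoc X (4 * K) 4 ⟩
    X + (4 * K + 4)  ≡⟨ cong (X +_) (+-comm (4 * K) 4) ⟩
    X + (4 + 4 * K)  ≡⟨ cong (X +_) (*-suc 4 K) ⟨
    X + 4 * suc K    ≡⟨ cong (λ n → X + 4 * n) (+-∸-assoc 1 c<p) ⟨
    X + 4 * (p ∸ c)  ∎
    where open ≡-Reasoning
  types′ : ∀ i → c ≤ i → i ≤ p → OfStartType π i a
  types′ i c≤i i≤p with m≤n⇒m<n∨m≡n c≤i
  ... | inj₁ c<i  = types i c<i i≤p
  ... | inj₂ refl = c-type

repeated-v+4-precedes : ∀ {π b v} → AllPairs _≥_ π → Even v → (∀ x → x ∈ π → Odd x → x < v) →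
  subᵉ 2 π (suc b) ≡ fin v → (v , 1) ∈ GG π → 2 ≤ count (v + 4) π →
  ∃ λ q → b ≡ suc q × subᵉ 2 π (suc q) ≡ fin (v + 4) × (v + 4 , 1) ∈ GG π
repeated-v+4-precedes {π} {b} {v} descending v-even odd<v πb≡v v¹ twice =
  conclude (predecessor-between b sub₂-strict b<N (∈-sub⁺ {π = π} (proj₂ v+4¹·²)) v<v+4)
  where
  b<N : suc b ≤ N 2 π
  b<N = proj₁ (subᵉ≡fin⇒ {π = π} πb≡v)
  at-b≡v : at (sub 2 π) (suc b) ≡ v
  at-b≡v = proj₂ (subᵉ≡fin⇒ {π = π} πb≡v)
  v<v+4 : at (sub 2 π) (suc b) < v + 4
  v<v+4 = subst (_< v + 4) (sym at-b≡v) (m<m+n v (s≤s z≤n))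
  v² : (v , 2) ∈ GG π
  v² = subst (λ x → (x , 2) ∈ GG π) at-b≡v (∈-sub⁻ {π = π} (at-∈ b b<N))
  open AboveDoublyMarked (GG-greedy π) (GG-descending descending) v-even
                         (λ y∈ → odd<v _ (∈-GG⇒∈ {π} y∈)) v¹ v²
  sub₂-strict : AllPairs _>_ (sub 2 π)
  sub₂-strict = 2-marked-strictly-decreasing (GG-greedy π) (GG-descending descending)
  v+4¹·² : (v + 4 , 1) ∈ GG π × (v + 4 , 2) ∈ GG π
  v+4¹·² = repeated-v+4-doubly-marked (subst (λ xs → 2 ≤ count (v + 4) xs) (sym (map-proj₁-GG π)) twice)
  conclude : (∃ λ q → b ≡ suc q × at (sub 2 π) (suc b) < at (sub 2 π) (suc q) × at (sub 2 π) (suc q) ≤ v + 4)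
    → ∃ λ q → b ≡ suc q × subᵉ 2 π (suc q) ≡ fin (v + 4) × (v + 4 , 1) ∈ GG π
  conclude (q , refl , v<πq , πq≤v+4) =
    q , refl , trans (subᵉ-at {π = π} q<N) (cong fin πq≡v+4) , proj₁ v+4¹·²
    where
    q<N : suc q ≤ N 2 π
    q<N = <⇒≤ b<N
    πq≡v+4 : at (sub 2 π) (suc q) ≡ v + 4
    πq≡v+4 = 2-marked-above-v≡v+4 (∈-sub⁻ {π = π} (at-∈ q q<N)) (subst (_< _) at-b≡v v<πq) πq≤v+4

proposition2p7 : (k r p t : ℕ) (π : List ℕ) →
    3 ≤ r → r ≤ k →
    InCless k r p t π →
    subᵉ 2 π p ≡ fin (2 * t + 2) →
    OfStartType π p s₃ →
    (p₁ : ℕ) → IsFirstCluster π p p₁ →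
    (v : ℕ) → subᵉ 2 π p₁ ≡ fin v →
    count (v + 4) π ≤ 1
proposition2p7 k r zero    t π _ _ _ () _ _ _ _ _
proposition2p7 k r (suc p) t π _ _ _ _ _ zero _ _ ()
proposition2p7 k r (suc p) t π _ _ ((partition , _) , odd<2t+1 , _) πₚ≡ s₃ₚ
               (suc b) (b<p , (πb≡ , _ , types) , first) v πb≡v =
  ≮⇒≥ λ twice →
    earlier-cluster (repeated-v+4-precedes {π} (partition-descending partition) v-even odd<v πb≡v v¹ twice)
  where
  v≡ : v ≡ at (sub 2 π) (suc p) + 4 * (suc p ∸ suc b)
  v≡ = fin-injective (trans (sym πb≡v) πb≡)
  v≡′ : v ≡ 2 * t + 2 + 4 * (suc p ∸ suc b)
  v≡′ = trans v≡ (cong (_+ _) (proj₂ (subᵉ≡fin⇒ {π = π} πₚ≡)))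
  v-even : Even v
  v-even = subst Even (sym v≡′) (even-progression t (suc p ∸ suc b))
  odd<v : ∀ x → x ∈ π → Odd x → x < v
  odd<v x x∈ x-odd = <-≤-trans (odd<2t+1 x x∈ x-odd)
    (subst (2 * t + 1 ≤_) (sym v≡′) (≤-trans (+-monoʳ-≤ (2 * t) (n≤1+n 1)) (m≤m+n (2 * t + 2) _)))
  types-s₃ : ∀ i → suc b ≤ i → i ≤ suc p → OfStartType π i s₃
  types-s₃ = subst (λ a → ∀ i → suc b ≤ i → i ≤ suc p → OfStartType π i a)
                   (OfStartType-unique {π} (types (suc p) b<p ≤-refl) s₃ₚ) types
  v¹ : (v , 1) ∈ GG π
  v¹ = s₃⇒1-marked {π} (types-s₃ (suc b) ≤-refl b<p) πb≡v
  earlier-cluster : (∃ λ q → b ≡ suc q × subᵉ 2 π (suc q) ≡ fin (v + 4) × (v + 4 , 1) ∈ GG π) → ⊥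
  earlier-cluster (q , refl , πq≡v+4 , v+4¹) = first (suc q) ≤-refl
    (extend-cluster b<p types-s₃ q-type (trans πq≡v+4 (cong (λ x → fin (x + 4)) v≡)))
    where
    q-type : OfStartType π (suc q) s₃
    q-type = 1-marked⇒s₃ {π} (≤-trans (n≤1+n _) (≤-trans b<p (s₃⇒≤lIdx {π} s₃ₚ))) πq≡v+4 v+4¹
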